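{- Run EdgePush with source $s$ and any thresholds $\theta(u,v)>0$. Then at every moment of its execution (initially and after every edge-based push), for every node $t\in V$, $$\boldsymbol\pi_s(t)=\alpha\,\mathbf q(t)+\sum_{\langle u,v\rangle\in\bar E}\mathbf R_{uv}\,\boldsymbol\pi_v(t).$$
   Context: $G=(V,E)$ is an undirected graph with symmetric non-negative weighted adjacency matrix $\mathbf A$; $\bar E$ contains both directed edges $\langle u,v\rangle,\langle v,u\rangle$ of each $\{u,v\}\in E$; $N(u)$ is the neighbor set of $u$, $d(u)=\sum_{v\in N(u)}\mathbf A_{uv}>0$, $\mathbf D=\mathrm{diag}(d(u))$, $\mathbf P=\mathbf A\mathbf D^{ -1}$. Fix $\alpha\in(0,1)$. For a node $x$, $\boldsymbol\pi_x=\alpha(\mathbf I-(1-\alpha)\mathbf P)^{ -1}\mathbf e_x$ is the Personalized PageRank vector with source $x$. EdgePush: given thresholds $\theta(u,v)>0$ for $\langle u,v\rangle\in\bar E$, it maintains a node income vector $\mathbf q\in\mathbb R^V$ and edge expenses $\mathbf{Q}_{uv}$, initialized $\mathbf q=\mathbf e_s$, $\mathbf Q=\mathbf 0$. The edge residue is $\mathbf R_{uv}=(1-\alpha)\mathbf q(u)\mathbf A_{uv}/d(u)-\mathbf Q_{uv}$. While some $\langle u,v\rangle\in\bar E$ has $\mathbf R_{uv}\ge\theta(u,v)$, it picks an arbitrary such edge, sets $y=\mathbf R_{uv}$ and performs an edge-based push $\mathbf Q_{uv}\leftarrow\mathbf Q_{uv}+y$, $\mathbf q(v)\leftarrow\mathbf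 q(v)+y$. On termination it outputs $\alpha\mathbf q$. -}

module Defs where

open import Level using (Level; _⊔_) renaming (suc to lsuc)
open import Data.Nat using (ℕ; zero; suc)
open import Data.Fin using (Fin; zero; suc; _≟_)
open import Data.Bool using (Bool; true; false; if_then_else_; _∧_)
open import Data.Product using (_×_; _,_)
open import Relation.Nullary using (¬_)
open import Relation.Nullary.Decidable using (⌊_⌋)
open import Relation.Binary.PropositionalEquality using (_≡_)
open import Relation.Binary.Structures using (IsTotalOrder)
open import Algebra.Bundles using (CommutativeRing)

-- Scalars: an arbitrary ordered field (the paper works over ℝ, which is one).

record OrderedField (c ℓ : Level) : Set (lsuc (c ⊔ ℓ)) where
  field
    commRing : CommutativeRing c ℓ
  open CommutativeRing commRing public hiding (zero)
  infix 4 _≤_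
  infix 8 _⁻¹
  field
    _≤_          : Carrier → Carrier → Set ℓ
    isTotalOrder : IsTotalOrder _≈_ _≤_
    +-mono-≤     : ∀ {x y} z → x ≤ y → x + z ≤ y + z
    *-nonneg     : ∀ {x y} → 0# ≤ x → 0# ≤ y → 0# ≤ x * y
    0≉1          : ¬ (0# ≈ 1#)
    _⁻¹          : Carrier → Carrier
    *-inverse    : ∀ x → ¬ (x ≈ 0#) → x * (x ⁻¹) ≈ 1#

  infix 4 _<_
  _<_ : Carrier → Carrier → Set ℓ
  x < y = (x ≤ y) × ¬ (x ≈ y)

  ∑ : ∀ n → (Fin n → Carrier) → Carrier
  ∑ zero    f = 0#
  ∑ (suc n) f = f zero + ∑ n (λ i → f (suc i))

  -- identity matrix / unit vectors: δ i j = (e_j)(i)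
  δ : ∀ {n} → Fin n → Fin n → Carrier
  δ i j = if ⌊ i ≟ j ⌋ then 1# else 0#

-- Weighted undirected graph on node set V = Fin n.
-- adj u v = true  iff  {u,v} ∈ E; hence Ē = {⟨u,v⟩ | adj u v = true}.

record WGraph {c ℓ} (𝔽 : OrderedField c ℓ) (n : ℕ) : Set (c ⊔ ℓ) where
  open OrderedField 𝔽
  field
    adj       : Fin n → Fin n → Bool
    adj-sym   : ∀ u v → adj u v ≡ adj v u
    A         : Fin n → Fin n → Carrier
    A-sym     : ∀ u v → A u v ≈ A v u
    A-nonneg  : ∀ u v → 0# ≤ A u v
    A-offE    : ∀ u v → adj u v ≡ false → A u v ≈ 0#

  d : Fin n → Carrier
  d u = ∑ n (λ v → if adj u v then A u v else 0#)

  field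
    d-pos : ∀ u → 0# < d u

  P : Fin n → Fin n → Carrier
  P u v = A u v * (d v ⁻¹)

module EdgePush {c ℓ} (𝔽 : OrderedField c ℓ) {n : ℕ} (G : WGraph 𝔽 n)
                (α : OrderedField.Carrier 𝔽) where
  open OrderedField 𝔽
  open WGraph G

  IsInverseOfIminusP : (Fin n → Fin n → Carrier) → Set ℓ
  IsInverseOfIminusP M =
      (∀ i j → ∑ n (λ k → M i k * (δ k j - (1# - α) * P k j)) ≈ δ i j)
    × (∀ i j → ∑ n (λ k → (δ i k - (1# - α) * P i k) * M k j) ≈ δ i j)

  -- π_x(t) = (α (I − (1−α)P)⁻¹ e_x)(t) = α · M t x
  ppr : (Fin n → Fin n → Carrier) → Fin n → Fin n → Carrier
  ppr M x t = α * M t x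

  -- EdgePush state: node income q and edge expenses Q
  record State : Set c where
    constructor ⟨_,_⟩
    field
      q : Fin n → Carrier
      Q : Fin n → Fin n → Carrier
  open State public

  initial : Fin n → State
  initial s = ⟨ δ s , (λ _ _ → 0#) ⟩

  R : State → Fin n → Fin n → Carrier
  R st u v = (1# - α) * q st u * A u v * (d u ⁻¹) - Q st u v

  push : State → Fin n → Fin n → Carrier → State
  push st u v y =
    ⟨ (λ w → if ⌊ w ≟ v ⌋ then q st w + y else q st w)
    , (λ a b → if ⌊ a ≟ u ⌋ ∧ ⌊ b ≟ v ⌋ then Q st a b + y else Q st a b) ⟩

  data Reachable (θ : Fin n → Fin n → Carrier) (s : Fin n) : State → Set (c ⊔ ℓ) where
    start : Reachable θ s (initial s)
    step  : ∀ {st} u v → Reachable θ s st → adj u v ≡ true → θ u v ≤ R st u v →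
            Reachable θ s (push st u v (R st u v))

  residueSum : (Fin n → Fin n → Carrier) → State → Fin n → Carrier
  residueSum M st t =
    ∑ n (λ u → ∑ n (λ v → if adj u v then R st u v * ppr M v t else 0#))

-- Fix the target t and weigh each node w by p w = π_w(t).  A push of y along
-- ⟨u,v⟩ adds y · p v both to the weighted income Σ_w q(w) p(w) and to the
-- weighted expense Σ_{⟨a,b⟩ ∈ Ē} Q_ab p(b); since q = e_s and Q = 0 at the
-- start, income = p s + expense throughout the run.  On the other hand the
-- recurrence p u = α e_u(t) + (1-α) Σ_{v ∈ N(u)} (A_uv / d(u)) p v, which is
-- M (I - (1-α) P) = I read through the symmetry of A, turns
-- α q(t) + Σ_Ē R_uv p(v) + expense into the income.  Cancelling the expense
-- gives the claim.
module Submission where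

open import Defs
open import Data.Nat using (ℕ; zero; suc)
open import Data.Fin using (Fin; zero; suc; _≟_)
open import Data.Bool using (Bool; true; false; if_then_else_; _∧_)
open import Data.Product using (_,_)
open import Function using (_∘_)
open import Relation.Nullary using (yes; no; contradiction)
open import Relation.Nullary.Decidable using (⌊_⌋)
open import Relation.Binary.PropositionalEquality as ≡ using (_≡_)
import Relation.Binary.Reasoning.Setoid as SetoidReasoning
import Algebra.Properties.Ring as RingProperties
import Algebra.Properties.Semiring.Sum as SemiringSum
import Algebra.Solver.CommutativeMonoid as CommutativeMonoidSolver

module Sums {c ℓ} (𝔽 : OrderedField c ℓ) where
  open OrderedField 𝔽
  open SetoidReasoning setoid
  private module Σ = SemiringSum semiring

  ∑≡sum : ∀ m (f : Fin m → Carrier) → ∑ m f ≡ Σ.sum f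
  ∑≡sum zero    f = ≡.refl
  ∑≡sum (suc m) f = ≡.cong (f zero +_) (∑≡sum m (f ∘ suc))

  ∑-cong : ∀ m {f g : Fin m → Carrier} → (∀ i → f i ≈ g i) → ∑ m f ≈ ∑ m g
  ∑-cong m {f} {g} f≈g = begin
    ∑ m f    ≡⟨ ∑≡sum m f ⟩
    Σ.sum f  ≈⟨ Σ.sum-cong-≋ f≈g ⟩
    Σ.sum g  ≡⟨ ∑≡sum m g ⟨
    ∑ m g    ∎

  ∑-zero : ∀ m {f : Fin m → Carrier} → (∀ i → f i ≈ 0#) → ∑ m f ≈ 0#
  ∑-zero m f≈0 = begin
    ∑ m _                 ≈⟨ ∑-cong m f≈0 ⟩
    ∑ m (λ _ → 0#)        ≡⟨ ∑≡sum m _ ⟩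
    Σ.sum {m} (λ _ → 0#)  ≈⟨ Σ.sum-replicate-zero m ⟩
    0#                    ∎

  ∑-distrib-+ : ∀ m (f g : Fin m → Carrier) → ∑ m (λ i → f i + g i) ≈ ∑ m f + ∑ m g
  ∑-distrib-+ m f g = begin
    ∑ m (λ i → f i + g i)      ≡⟨ ∑≡sum m _ ⟩
    Σ.sum (λ i → f i + g i)    ≈⟨ Σ.∑-distrib-+ f g ⟩
    Σ.sum f + Σ.sum g          ≡⟨ ≡.cong₂ _+_ (∑≡sum m f) (∑≡sum m g) ⟨
    ∑ m f + ∑ m g              ∎

  *-distribˡ-∑ : ∀ m k (f : Fin m → Carrier) → ∑ m (λ i → k * f i) ≈ k * ∑ m f
  *-distribˡ-∑ m k f = begin
    ∑ m (λ i → k * f i)     ≡⟨ ∑≡sum m _ ⟩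
    Σ.sum (λ i → k * f i)   ≈⟨ Σ.*-distribˡ-sum k f ⟨
    k * Σ.sum f             ≡⟨ ≡.cong (k *_) (∑≡sum m f) ⟨
    k * ∑ m f               ∎

  δ-sym : ∀ {m} (i j : Fin m) → δ i j ≡ δ j i
  δ-sym i j with i ≟ j | j ≟ i
  ... | yes _   | yes _   = ≡.refl
  ... | no _    | no _    = ≡.refl
  ... | yes i≡j | no j≢i  = contradiction (≡.sym i≡j) j≢i
  ... | no i≢j  | yes j≡i = contradiction (≡.sym j≡i) i≢j

  δ-suc : ∀ {m} (i j : Fin m) → δ (suc i) (suc j) ≡ δ i j
  δ-suc i j with i ≟ j
  ... | yes _ = ≡.refl
  ... | no _  = ≡.refl

  ∑-δ : ∀ m (f : Fin m → Carrier) j → ∑ m (λ k → δ k j * f k) ≈ f j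
  ∑-δ (suc m) f zero = begin
    1# * f zero + ∑ m (λ k → 0# * f (suc k))  ≈⟨ +-cong (*-identityˡ _) (∑-zero m (λ k → zeroˡ _)) ⟩
    f zero + 0#                               ≈⟨ +-identityʳ _ ⟩
    f zero                                    ∎
  ∑-δ (suc m) f (suc j) = begin
    0# * f zero + ∑ m (λ k → δ (suc k) (suc j) * f (suc k))
      ≈⟨ +-cong (zeroˡ _) (∑-cong m (λ k → *-congʳ (reflexive (δ-suc k j)))) ⟩
    0# + ∑ m (λ k → δ k j * f (suc k))
      ≈⟨ +-identityˡ _ ⟩
    ∑ m (λ k → δ k j * f (suc k))
      ≈⟨ ∑-δ m (f ∘ suc) j ⟩
    f (suc j) ∎

  x-y+y≈x : ∀ x y → x - y + y ≈ x
  x-y+y≈x x y = trans (+-assoc x (- y) y) (trans (+-congˡ (-‿inverseˡ y)) (+-identityʳ x))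

  left-inverse-column : ∀ {m} (M B : Fin m → Fin m → Carrier) →
    (∀ i j → ∑ m (λ k → M i k * (δ k j - B k j)) ≈ δ i j) →
    ∀ i j → M i j ≈ δ i j + ∑ m (λ k → M i k * B k j)
  left-inverse-column {m} M B left i j = begin
    M i j
      ≈⟨ ∑-δ m (M i) j ⟨
    ∑ m (λ k → δ k j * M i k)
      ≈⟨ ∑-cong m split ⟩
    ∑ m (λ k → M i k * (δ k j - B k j) + M i k * B k j)
      ≈⟨ ∑-distrib-+ m _ _ ⟩
    ∑ m (λ k → M i k * (δ k j - B k j)) + ∑ m (λ k → M i k * B k j)
      ≈⟨ +-congʳ (left i j) ⟩
    δ i j + ∑ m (λ k → M i k * B k j) ∎
    where
    split : ∀ k → δ k j * M i k ≈ M i k * (δ k j - B k j) + M i k * B k j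
    split k = begin
      δ k j * M i k                          ≈⟨ *-comm _ _ ⟩
      M i k * δ k j                          ≈⟨ *-congˡ (x-y+y≈x (δ k j) (B k j)) ⟨
      M i k * (δ k j - B k j + B k j)        ≈⟨ distribˡ _ _ _ ⟩
      M i k * (δ k j - B k j) + M i k * B k j ∎

  𝟙 : Bool → Carrier
  𝟙 b = if b then 1# else 0#

  𝟙-∧ : ∀ b₁ b₂ → 𝟙 (b₁ ∧ b₂) ≈ 𝟙 b₁ * 𝟙 b₂
  𝟙-∧ true  b₂ = sym (*-identityˡ _)
  𝟙-∧ false b₂ = sym (zeroˡ _)

  if-+-else : ∀ b x y → (if b then x + y else x) ≈ x + 𝟙 b * y
  if-+-else true  x y = +-congˡ (sym (*-identityˡ y))
  if-+-else false x y = sym (trans (+-congˡ (zeroˡ y)) (+-identityʳ x))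

  if-+-else-* : ∀ b x y z → (if b then x + y else x) * z ≈ x * z + 𝟙 b * (y * z)
  if-+-else-* b x y z = begin
    (if b then x + y else x) * z  ≈⟨ *-congʳ (if-+-else b x y) ⟩
    (x + 𝟙 b * y) * z             ≈⟨ distribʳ z x _ ⟩
    x * z + 𝟙 b * y * z           ≈⟨ +-congˡ (*-assoc _ y z) ⟩
    x * z + 𝟙 b * (y * z)         ∎

  if-else-0-cong : ∀ b {x y} → x ≈ y → (if b then x else 0#) ≈ (if b then y else 0#)
  if-else-0-cong true  x≈y = x≈y
  if-else-0-cong false x≈y = refl

  if-else-0-zero : ∀ b {x} → x ≈ 0# → (if b then x else 0#) ≈ 0#
  if-else-0-zero true  x≈0 = x≈0
  if-else-0-zero false x≈0 = refl

  if-else-0-+ : ∀ b x y → (if b then x + y else 0#) ≈ (if b then x else 0#) + (if b then y else 0#)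
  if-else-0-+ true  x y = refl
  if-else-0-+ false x y = sym (+-identityˡ 0#)

  if-else-0-* : ∀ b k x → (if b then k * x else 0#) ≈ k * (if b then x else 0#)
  if-else-0-* true  k x = refl
  if-else-0-* false k x = sym (zeroʳ k)

module GraphSums {c ℓ} (𝔽 : OrderedField c ℓ) {n : ℕ} (G : WGraph 𝔽 n) where
  open OrderedField 𝔽
  open WGraph G
  open Sums 𝔽
  open SetoidReasoning setoid

  ∑N : Fin n → (Fin n → Carrier) → Carrier
  ∑N u f = ∑ n (λ v → if adj u v then f v else 0#)

  ∑Ē : (Fin n → Fin n → Carrier) → Carrier
  ∑Ē f = ∑ n (λ u → ∑N u (f u))

  ∑N-cong : ∀ u {f g : Fin n → Carrier} → (∀ v → f v ≈ g v) → ∑N u f ≈ ∑N u g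
  ∑N-cong u f≈g = ∑-cong n (λ v → if-else-0-cong (adj u v) (f≈g v))

  *-distribˡ-∑N : ∀ u k (f : Fin n → Carrier) → ∑N u (λ v → k * f v) ≈ k * ∑N u f
  *-distribˡ-∑N u k f =
    trans (∑-cong n (λ v → if-else-0-* (adj u v) k (f v))) (*-distribˡ-∑ n k _)

  ∑N≈∑ : ∀ u {f : Fin n → Carrier} → (∀ v → adj u v ≡ false → f v ≈ 0#) → ∑N u f ≈ ∑ n f
  ∑N≈∑ u {f} f≈0 = ∑-cong n outsideN
    where
    outsideN : ∀ v → (if adj u v then f v else 0#) ≈ f v
    outsideN v with adj u v in eq
    ... | true  = refl
    ... | false = sym (f≈0 v eq)

  ∑Ē-cong : ∀ {f g : Fin n → Fin n → Carrier} → (∀ u v → f u v ≈ g u v) → ∑Ē f ≈ ∑Ē g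
  ∑Ē-cong f≈g = ∑-cong n (λ u → ∑N-cong u (f≈g u))

  ∑Ē-zero : ∀ {f : Fin n → Fin n → Carrier} → (∀ u v → f u v ≈ 0#) → ∑Ē f ≈ 0#
  ∑Ē-zero f≈0 =
    ∑-zero n (λ u → ∑-zero n (λ v → if-else-0-zero (adj u v) (f≈0 u v)))

  ∑Ē-distrib-+ : ∀ (f g : Fin n → Fin n → Carrier) →
                 ∑Ē (λ u v → f u v + g u v) ≈ ∑Ē f + ∑Ē g
  ∑Ē-distrib-+ f g = begin
    ∑Ē (λ u v → f u v + g u v)
      ≈⟨ ∑-cong n (λ u → ∑-cong n (λ v → if-else-0-+ (adj u v) (f u v) (g u v))) ⟩
    ∑ n (λ u → ∑ n (λ v → (if adj u v then f u v else 0#) + (if adj u v then g u v else 0#)))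
      ≈⟨ ∑-cong n (λ u → ∑-distrib-+ n _ _) ⟩
    ∑ n (λ u → ∑N u (f u) + ∑N u (g u))
      ≈⟨ ∑-distrib-+ n _ _ ⟩
    ∑Ē f + ∑Ē g ∎

  ∑Ē-δ : ∀ {u v} (f : Fin n → Fin n → Carrier) → adj u v ≡ true →
         ∑Ē (λ a b → δ a u * (δ b v * f a b)) ≈ f u v
  ∑Ē-δ {u} {v} f uv∈Ē = begin
    ∑Ē (λ a b → δ a u * (δ b v * f a b))
      ≈⟨ ∑-cong n (λ a → *-distribˡ-∑N a (δ a u) _) ⟩
    ∑ n (λ a → δ a u * ∑N a (λ b → δ b v * f a b))
      ≈⟨ ∑-δ n _ u ⟩
    ∑N u (λ b → δ b v * f u b)
      ≈⟨ ∑-cong n (λ b → if-else-0-* (adj u b) (δ b v) (f u b)) ⟩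
    ∑ n (λ b → δ b v * (if adj u b then f u b else 0#))
      ≈⟨ ∑-δ n _ v ⟩
    (if adj u v then f u v else 0#)
      ≡⟨ ≡.cong (λ b → if b then f u v else 0#) uv∈Ē ⟩
    f u v ∎

module PushInvariant {c ℓ} (𝔽 : OrderedField c ℓ) {n : ℕ} (G : WGraph 𝔽 n)
                     (α : OrderedField.Carrier 𝔽) where
  open OrderedField 𝔽
  open WGraph G
  open EdgePush 𝔽 G α
  open Sums 𝔽
  open GraphSums 𝔽 G
  open SetoidReasoning setoid
  open CommutativeMonoidSolver *-commutativeMonoid using (solve; _⊕_; _⊜_)

  income : (Fin n → Carrier) → State → Carrier
  income p st = ∑ n (λ u → q st u * p u)

  expense : (Fin n → Carrier) → State → Carrier
  expense p st = ∑Ē (λ u v → Q st u v * p v)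

  income-push : ∀ p st u v y → income p (push st u v y) ≈ income p st + y * p v
  income-push p st u v y = begin
    income p (push st u v y)
      ≈⟨ ∑-cong n (λ w → if-+-else-* ⌊ w ≟ v ⌋ (q st w) y (p w)) ⟩
    ∑ n (λ w → q st w * p w + δ w v * (y * p w))
      ≈⟨ ∑-distrib-+ n _ _ ⟩
    income p st + ∑ n (λ w → δ w v * (y * p w))
      ≈⟨ +-congˡ (∑-δ n _ v) ⟩
    income p st + y * p v ∎

  expense-push : ∀ p st {u v} y → adj u v ≡ true →
                 expense p (push st u v y) ≈ expense p st + y * p v
  expense-push p st {u} {v} y uv∈Ē = begin
    expense p (push st u v y)
      ≈⟨ ∑Ē-cong (λ a b → trans (if-+-else-* (⌊ a ≟ u ⌋ ∧ ⌊ b ≟ v ⌋) (Q st a b) y (p b))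
                                (+-congˡ (pointMass a b))) ⟩
    ∑Ē (λ a b → Q st a b * p b + δ a u * (δ b v * (y * p b)))
      ≈⟨ ∑Ē-distrib-+ _ _ ⟩
    expense p st + ∑Ē (λ a b → δ a u * (δ b v * (y * p b)))
      ≈⟨ +-congˡ (∑Ē-δ _ uv∈Ē) ⟩
    expense p st + y * p v ∎
    where
    pointMass : ∀ a b → 𝟙 (⌊ a ≟ u ⌋ ∧ ⌊ b ≟ v ⌋) * (y * p b) ≈ δ a u * (δ b v * (y * p b))
    pointMass a b = trans (*-congʳ (𝟙-∧ _ _)) (*-assoc _ _ _)

  conservation : ∀ {θ s st} (p : Fin n → Carrier) → Reachable θ s st →
                 income p st ≈ p s + expense p st
  conservation {s = s} p start = begin
    income p (initial s)          ≈⟨ ∑-cong n (λ u → *-congʳ (reflexive (δ-sym s u))) ⟩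
    ∑ n (λ u → δ u s * p u)       ≈⟨ ∑-δ n p s ⟩
    p s                           ≈⟨ +-identityʳ _ ⟨
    p s + 0#                      ≈⟨ +-congˡ (∑Ē-zero (λ u v → zeroˡ (p v))) ⟨
    p s + expense p (initial s)   ∎
  conservation {s = s} p (step {st} u v reachable uv∈Ē _) = begin
    income p (push st u v y)         ≈⟨ income-push p st u v y ⟩
    income p st + y * p v            ≈⟨ +-congʳ (conservation p reachable) ⟩
    p s + expense p st + y * p v     ≈⟨ +-assoc _ _ _ ⟩
    p s + (expense p st + y * p v)   ≈⟨ +-congˡ (expense-push p st y uv∈Ē) ⟨
    p s + expense p (push st u v y)  ∎
    where
    y : Carrier
    y = R st u v

  PPRRecurrence : Fin n → (Fin n → Carrier) → Set ℓ
  PPRRecurrence t p = ∀ u → p u ≈ α * δ u t + ∑N u (λ v → (1# - α) * A u v * d u ⁻¹ * p v)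

  ppr-recurrence : ∀ (M : Fin n → Fin n → Carrier) → IsInverseOfIminusP M → ∀ t → PPRRecurrence t (λ v → ppr M v t)
  ppr-recurrence M (left-inverse , _) t u = begin
    α * M t u
      ≈⟨ *-congˡ (left-inverse-column M (λ k j → (1# - α) * P k j) left-inverse t u) ⟩
    α * (δ t u + ∑ n (λ k → M t k * ((1# - α) * P k u)))
      ≈⟨ distribˡ α _ _ ⟩
    α * δ t u + α * ∑ n (λ k → M t k * ((1# - α) * P k u))
      ≈⟨ +-cong (*-congˡ (reflexive (δ-sym u t))) (*-distribˡ-∑ n α _) ⟨
    α * δ u t + ∑ n (λ k → α * (M t k * ((1# - α) * P k u)))
      ≈⟨ +-congˡ (∑-cong n reversed) ⟩
    α * δ u t + ∑ n (λ v → (1# - α) * A u v * d u ⁻¹ * (α * M t v))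
      ≈⟨ +-congˡ (∑N≈∑ u offN) ⟨
    α * δ u t + ∑N u (λ v → (1# - α) * A u v * d u ⁻¹ * (α * M t v)) ∎
    where
    reversed : ∀ k → α * (M t k * ((1# - α) * P k u)) ≈ (1# - α) * A u k * d u ⁻¹ * (α * M t k)
    reversed k = trans
      (solve 5 (λ a m c w i → a ⊕ (m ⊕ (c ⊕ (w ⊕ i))) ⊜ ((c ⊕ w) ⊕ i) ⊕ (a ⊕ m)) refl
             α (M t k) (1# - α) (A k u) (d u ⁻¹))
      (*-congʳ (*-congʳ (*-congˡ (A-sym k u))))
    offN : ∀ v → adj u v ≡ false → (1# - α) * A u v * d u ⁻¹ * (α * M t v) ≈ 0#
    offN v uv∉Ē = begin
      (1# - α) * A u v * d u ⁻¹ * (α * M t v)  ≈⟨ *-congʳ (*-congʳ (*-congˡ (A-offE u v uv∉Ē))) ⟩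
      (1# - α) * 0# * d u ⁻¹ * (α * M t v)     ≈⟨ *-congʳ (*-congʳ (zeroʳ _)) ⟩
      0# * d u ⁻¹ * (α * M t v)                ≈⟨ *-congʳ (zeroˡ _) ⟩
      0# * (α * M t v)                         ≈⟨ zeroˡ _ ⟩
      0#                                       ∎

  residue-identity : ∀ t p → PPRRecurrence t p → ∀ st →
    α * q st t + ∑Ē (λ u v → R st u v * p v) + expense p st ≈ income p st
  residue-identity t p recurrence st = begin
    α * q st t + ∑Ē (λ u v → R st u v * p v) + expense p st
      ≈⟨ +-assoc _ _ _ ⟩
    α * q st t + (∑Ē (λ u v → R st u v * p v) + expense p st)
      ≈⟨ +-congˡ (∑Ē-distrib-+ _ _) ⟨
    α * q st t + ∑Ē (λ u v → R st u v * p v + Q st u v * p v)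
      ≈⟨ +-congˡ (∑Ē-cong residue+expense) ⟩
    α * q st t + ∑Ē (λ u v → q st u * K u v)
      ≈⟨ +-cong (∑-δ n _ t) (∑-cong n (λ u → sym (*-distribˡ-∑N u (q st u) (K u)))) ⟨
    ∑ n (λ u → δ u t * (α * q st u)) + ∑ n (λ u → q st u * ∑N u (K u))
      ≈⟨ ∑-distrib-+ n _ _ ⟨
    ∑ n (λ u → δ u t * (α * q st u) + q st u * ∑N u (K u))
      ≈⟨ ∑-cong n atNode ⟩
    income p st ∎
    where
    K : Fin n → Fin n → Carrier
    K u v = (1# - α) * A u v * d u ⁻¹ * p v

    residue+expense : ∀ u v → R st u v * p v + Q st u v * p v ≈ q st u * K u v
    residue+expense u v = begin
      R st u v * p v + Q st u v * p v
        ≈⟨ distribʳ _ _ _ ⟨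
      (R st u v + Q st u v) * p v
        ≈⟨ *-congʳ (x-y+y≈x _ _) ⟩
      (1# - α) * q st u * A u v * d u ⁻¹ * p v
        ≈⟨ solve 5 (λ c x a i y → (((c ⊕ x) ⊕ a) ⊕ i) ⊕ y ⊜ x ⊕ (((c ⊕ a) ⊕ i) ⊕ y)) refl
                 (1# - α) (q st u) (A u v) (d u ⁻¹) (p v) ⟩
      q st u * K u v ∎

    atNode : ∀ u → δ u t * (α * q st u) + q st u * ∑N u (K u) ≈ q st u * p u
    atNode u = begin
      δ u t * (α * q st u) + q st u * ∑N u (K u)
        ≈⟨ +-congʳ (solve 3 (λ i a x → i ⊕ (a ⊕ x) ⊜ x ⊕ (a ⊕ i)) refl (δ u t) α (q st u)) ⟩
      q st u * (α * δ u t) + q st u * ∑N u (K u)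
        ≈⟨ distribˡ _ _ _ ⟨
      q st u * (α * δ u t + ∑N u (K u))
        ≈⟨ *-congˡ (recurrence u) ⟨
      q st u * p u ∎

-- The bounds on α and the positivity of θ only matter for termination.
lemma4p1 : ∀ {c ℓ} (𝔽 : OrderedField c ℓ) (n : ℕ) (G : WGraph 𝔽 n)
    (α : OrderedField.Carrier 𝔽) →
    let open OrderedField 𝔽 in let open WGraph G in let open EdgePush 𝔽 G α in
    0# < α → α < 1# →
    (M : Fin n → Fin n → Carrier) → IsInverseOfIminusP M →
    (θ : Fin n → Fin n → Carrier) → (∀ u v → adj u v ≡ true → 0# < θ u v) →
    (s : Fin n) → (st : State) → Reachable θ s st →
    (t : Fin n) → ppr M s t ≈ α * q st t + residueSum M st t
lemma4p1 𝔽 n G α _ _ M inverse _ _ s st reachable t =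
  +-cancelʳ (expense p st) _ _ (begin
    ppr M s t + expense p st                       ≈⟨ conservation p reachable ⟨
    income p st                                    ≈⟨ residue-identity t p (ppr-recurrence M inverse t) st ⟨
    α * q st t + residueSum M st t + expense p st  ∎)
  where
  open OrderedField 𝔽
  open EdgePush 𝔽 G α
  open PushInvariant 𝔽 G α
  open RingProperties ring using (+-cancelʳ)
  open SetoidReasoning setoid

  p : Fin n → Carrier
  p v = ppr M v t
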